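{- Let $a,b$ be integers with $1\leq a\leq b$. The number of covering relations in the interval $[UD,U^aD^aU^bD^b]$ of the Dyck pattern poset (i.e. the number of edges of its Hasse diagram) is $$-\frac13\left(2a^3-6a^2b+a-3b+3\right).$$
   Context: A Dyck path is a word over $\{U,D\}$ with equally many $U$'s and $D$'s such that every prefix has at least as many $U$'s as $D$'s; its semilength is its number of $U$'s. The Dyck pattern poset is the set of nonempty Dyck paths ordered by $P\leq Q$ iff $P$ is a subword of $Q$ (obtained by deleting letters, not necessarily consecutive); it is graded by semilength. $U^a$ denotes $a$ consecutive $U$'s. The paper assumes throughout this section that $b\geq a\geq1$. -}

module Defs where

open import Data.Nat using (ℕ; zero; suc)
open import Data.List using (List; []; _∷_; _++_; replicate; length)
open import Data.List.Relation.Binary.Sublist.Propositional using (_⊆_)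
open import Data.List.Relation.Unary.Unique.Propositional using (Unique)
open import Data.List.Membership.Propositional using (_∈_)
open import Data.Product using (Σ; _×_; ∃)
open import Relation.Binary.PropositionalEquality using (_≡_)
open import Relation.Nullary using (¬_)
open import Function.Bundles using (_⇔_)

data Step : Set where
  U D : Step

-- Word w read from current height h stays ≥ 0 and ends at height 0.
data FromHeight : ℕ → List Step → Set where
  done : FromHeight zero []
  up   : ∀ {h w} → FromHeight (suc h) w → FromHeight h (U ∷ w)
  down : ∀ {h w} → FromHeight h w → FromHeight (suc h) (D ∷ w)

Dyck : List Step → Set
Dyck w = FromHeight zero w

NonEmpty : List Step → Set
NonEmpty w = ¬ (w ≡ [])

Elem : List Step → Set
Elem w = Dyck w × NonEmpty w

-- Pattern order: subword (deletion of letters, not necessarily consecutive).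
_≼_ : List Step → List Step → Set
P ≼ Q = P ⊆ Q

_≺_ : List Step → List Step → Set
P ≺ Q = P ≼ Q × ¬ (P ≡ Q)

_⋖_ : List Step → List Step → Set
P ⋖ Q = Elem P × Elem Q × P ≺ Q ×
        (∀ S → Elem S → P ≺ S → ¬ (S ≺ Q))

InInterval : List Step → List Step → List Step → Set
InInterval L H P = Elem P × L ≼ P × P ≼ H

CoverIn : List Step → List Step → List Step × List Step → Set
CoverIn L H (P Data.Product., Q) = InInterval L H P × InInterval L H Q × P ⋖ Q

HasCard : {A : Set} → (A → Set) → ℕ → Set
HasCard {A} Pr n = Σ (List A) λ xs → Unique xs × (∀ x → (x ∈ xs) ⇔ Pr x) × length xs ≡ n

UD : List Step
UD = U ∷ D ∷ []

twoPeaks : ℕ → ℕ → List Step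
twoPeaks a b = replicate a U ++ replicate a D ++ replicate b U ++ replicate b D

-- Covers in the Dyck pattern poset are exactly the subword relations P ⊆ Q with |Q| = |P| + 2:
-- deleting the first letter of Q skipped by P together with a matching letter gives a Dyck path
-- between them two letters shorter than Q, and Dyck paths have even length.
-- The elements of [UD, U^a D^a U^b D^b] are the nonempty paths U^(q+e) D^q U^r D^(r+e) with one
-- or two peaks, and such a path has at most four lower covers: merge the peaks through the valley,
-- lower the valley, or shrink one peak. Summing these numbers over the interval, grouped by the
-- height of the valley (raising it embeds the (a, b) case into the (a+1, b+1) case), gives the cubic.

module Submission where

open import Defs
open import Data.Nat using (ℕ; zero; suc; _+_; _*_; _^_; _≤_; _<_; z≤n; s≤s)
open import Data.Nat.Properties
open import Data.List
  using (List; []; _∷_; _++_; replicate; length; map; concatMap; applyDownFrom; downFrom; cartesianProductWith)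
open import Data.List.Properties
  using (length-++; length-replicate; length-map; ++-assoc; ++-identityʳ; ∷-injectiveˡ; ∷-injectiveʳ; map-++)
open import Data.Nat.ListAction using (sum)
open import Data.Nat.ListAction.Properties using (sum-++)
open import Algebra.Properties.CommutativeSemigroup +-commutativeSemigroup using (interchange)
open import Data.Nat.Tactic.RingSolver using (solve)
open import Data.List.Relation.Binary.Sublist.Propositional
  using (_⊆_; []; _∷_; _∷ʳ_; ⊆-refl; ⊆-trans)
open import Data.List.Relation.Binary.Sublist.Propositional.Properties
  using (length-mono-≤; to-≋; ++⁺; []⊆-universal)
open import Data.List.Relation.Binary.Equality.Propositional using (≋⇒≡)
open import Data.Product using (Σ; ∃-syntax; _×_; _,_; proj₁; proj₂; uncurry)
open import Data.Empty using (⊥-elim)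
open import Data.Sum using (inj₁; inj₂)
open import Data.List.Membership.Propositional using (_∈_; _∉_; find; lose)
open import Data.List.Membership.Propositional.Properties
  using (∈-++⁻; ∈-++⁺ˡ; ∈-++⁺ʳ; ∈-map⁺; ∈-map⁻; ∈-applyDownFrom⁺; ∈-applyDownFrom⁻; ∈-downFrom⁺; ∈-downFrom⁻;
         ∈-cartesianProductWith⁺; ∈-cartesianProductWith⁻; ∈-concatMap⁺; ∈-concatMap⁻)
open import Data.List.Relation.Unary.Any using (here; there)
import Data.List.Relation.Unary.All as All
import Data.List.Relation.Unary.All.Properties as Allₚ
import Data.List.Relation.Unary.AllPairs as AllPairs
import Data.List.Relation.Unary.AllPairs.Properties as AllPairsₚ
open import Data.List.Relation.Unary.Unique.Propositional using (Unique)
import Data.List.Relation.Unary.Unique.Propositional.Properties as Uniqueₚ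
open import Data.List.Relation.Binary.Disjoint.Propositional using (Disjoint)
open import Relation.Nullary using (¬_; yes; no)
open import Relation.Binary.PropositionalEquality
open import Function.Bundles using (_⇔_; mk⇔; Equivalence)

Word : Set
Word = List Step

-- Covers are the steps of length two

⊆∧length≥⇒≡ : ∀ {P Q : Word} → P ⊆ Q → length Q ≤ length P → P ≡ Q
⊆∧length≥⇒≡ P⊆Q |Q|≤|P| = ≋⇒≡ (to-≋ (≤-antisym (length-mono-≤ P⊆Q) |Q|≤|P|) P⊆Q)

⊂⇒length< : ∀ {P Q : Word} → P ⊆ Q → P ≢ Q → length P < length Q
⊂⇒length< P⊆Q P≢Q = ≤∧≢⇒< (length-mono-≤ P⊆Q) (λ e → P≢Q (⊆∧length≥⇒≡ P⊆Q (≤-reflexive (sym e))))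

FromHeight⇒even : ∀ {h w} → FromHeight h w → ∃[ k ] h + length w ≡ 2 * k
FromHeight⇒even done = 0 , refl
FromHeight⇒even {h} {U ∷ w} (up p) with k , e ← FromHeight⇒even p = k , trans (+-suc h (length w)) e
FromHeight⇒even {suc h} {D ∷ w} (down p) with k , e ← FromHeight⇒even p =
  suc k , trans (cong suc (+-suc h (length w))) (trans (cong (2 +_) e) (sym (*-suc 2 k)))

data Between (h : ℕ) (P Q : Word) (n : ℕ) : Set where
  between : ∀ {S} → FromHeight h S → P ⊆ S → S ⊆ Q → n + length S ≡ length Q → Between h P Q n

module _ {P Q : Word} {n : ℕ} where

  keepU : ∀ {h} → Between (suc h) P Q n → Between h (U ∷ P) (U ∷ Q) n
  keepU (between f σ τ e) = between (up f) (refl ∷ σ) (refl ∷ τ) (trans (+-suc n _) (cong suc e))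

  keepD : ∀ {h} → Between h P Q n → Between (suc h) (D ∷ P) (D ∷ Q) n
  keepD (between f σ τ e) = between (down f) (refl ∷ σ) (refl ∷ τ) (trans (+-suc n _) (cong suc e))

  skipU : ∀ {h} → Between (suc h) P Q n → Between h P (U ∷ Q) n
  skipU (between f σ τ e) = between (up f) (U ∷ʳ σ) (refl ∷ τ) (trans (+-suc n _) (cong suc e))

  skipD : ∀ {h} → Between h P Q n → Between (suc h) P (D ∷ Q) n
  skipD (between f σ τ e) = between (down f) (D ∷ʳ σ) (refl ∷ τ) (trans (+-suc n _) (cong suc e))

  grow : ∀ {h} (x : Step) → Between h P Q n → Between h P (x ∷ Q) (suc n)
  grow x (between f σ τ e) = between f σ (x ∷ʳ τ) (cong suc e)

dropSkippedU : ∀ {hp hq} {P Q : Word} → hq < hp → FromHeight hp P → FromHeight hq Q → P ⊆ Q →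
               Between (suc hq) P Q 1
dropSkippedU () done done []
dropSkippedU _ _ (up fq) (_ ∷ʳ σ) = between fq σ (U ∷ʳ ⊆-refl) refl
dropSkippedU (s≤s lt) fp (down fq) (_ ∷ʳ σ) = skipD (dropSkippedU (m<n⇒m<1+n lt) fp fq σ)
dropSkippedU lt (up fp) (up fq) (refl ∷ σ) = keepU (dropSkippedU (s≤s lt) fp fq σ)
dropSkippedU (s≤s lt) (down fp) (down fq) (refl ∷ σ) = keepD (dropSkippedU lt fp fq σ)

dropSkippedD : ∀ {hp hq} {P Q : Word} → hp ≤ hq → FromHeight hp P → FromHeight (suc hq) Q → P ⊆ Q →
               Between hq P Q 1
dropSkippedD le fp (up fq) (_ ∷ʳ σ) = skipU (dropSkippedD (m≤n⇒m≤1+n le) fp fq σ)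
dropSkippedD _ _ (down fq) (_ ∷ʳ σ) = between fq σ (D ∷ʳ ⊆-refl) refl
dropSkippedD le (up fp) (up fq) (refl ∷ σ) = keepU (dropSkippedD (s≤s le) fp fq σ)
dropSkippedD (s≤s le) (down fp) (down fq) (refl ∷ σ) = keepD (dropSkippedD le fp fq σ)

-- The first letter of Q skipped by P is deleted together with a matching letter further on.
interpolate : ∀ {h} {P Q : Word} → FromHeight h P → FromHeight h Q → P ⊆ Q → length P < length Q →
              Between h P Q 2
interpolate done done [] ()
interpolate fp (up fq) (_ ∷ʳ σ) _ = grow U (dropSkippedD ≤-refl fp fq σ)
interpolate fp (down fq) (_ ∷ʳ σ) _ = grow D (dropSkippedU ≤-refl fp fq σ)
interpolate (up fp) (up fq) (refl ∷ σ) (s≤s lt) = keepU (interpolate fp fq σ lt)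
interpolate (down fp) (down fq) (refl ∷ σ) (s≤s lt) = keepD (interpolate fp fq σ lt)

⋖⇒length≡2+ : ∀ {P Q : Word} → P ⋖ Q → length Q ≡ 2 + length P
⋖⇒length≡2+ {P} {Q} ((dP , _) , (dQ , _) , (P⊆Q , P≢Q) , maximal)
  with between {S} dS P⊆S S⊆Q e ← interpolate dP dQ P⊆Q (⊂⇒length< P⊆Q P≢Q)
  with length P <? length S
... | yes P<S = ⊥-elim (maximal S (dS , S≢[]) (P⊆S , P≢S) (S⊆Q , S≢Q))
  where
  S≢[] : S ≢ []
  S≢[] refl = ≤⇒≯ z≤n P<S
  P≢S : P ≢ S
  P≢S refl = <-irrefl refl P<S
  S≢Q : S ≢ Q
  S≢Q refl = <-irrefl refl (≤-trans (n≤1+n _) (≤-reflexive e))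
... | no P≮S with refl ← ⊆∧length≥⇒≡ P⊆S (≮⇒≥ P≮S) = sym e

-- Dyck paths have even length, so nothing fits strictly between lengths ℓ and ℓ + 2.
length≡2+⇒⋖ : ∀ {P Q : Word} → Elem P → Elem Q → P ⊆ Q → length Q ≡ 2 + length P → P ⋖ Q
length≡2+⇒⋖ {P} {Q} eP eQ P⊆Q e = eP , eQ , (P⊆Q , P≢Q) , maximal
  where
  P≢Q : P ≢ Q
  P≢Q refl = <-irrefl refl (≤-trans (n≤1+n _) (≤-reflexive (sym e)))
  maximal : ∀ S → Elem S → P ≺ S → ¬ (S ≺ Q)
  maximal S (dS , _) (P⊆S , P≢S) (S⊆Q , S≢Q)
    with k , ek ← FromHeight⇒even (proj₁ eP) | m , em ← FromHeight⇒even dS =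
    even≢odd m k (trans (sym em) (trans |S|≡1+|P| (cong suc ek)))
    where
    |S|≡1+|P| : length S ≡ suc (length P)
    |S|≡1+|P| = ≤-antisym (≤-pred (≤-trans (⊂⇒length< S⊆Q S≢Q) (≤-reflexive e))) (⊂⇒length< P⊆S P≢S)

⋖⇒⊆ : ∀ {P Q : Word} → P ⋖ Q → P ⊆ Q
⋖⇒⊆ (_ , _ , (P⊆Q , _) , _) = P⊆Q

D⊆ : ∀ {h} {w : Word} → FromHeight (suc h) w → D ∷ [] ⊆ w
D⊆ (up f) = U ∷ʳ D⊆ f
D⊆ (down {w = w} f) = refl ∷ []⊆-universal w

UD⊆ : ∀ {P : Word} → Elem P → UD ⊆ P
UD⊆ {[]} (_ , P≢[]) = ⊥-elim (P≢[] refl)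
UD⊆ {U ∷ P} (up f , _) = refl ∷ D⊆ f

replicate⁺ : ∀ {m n} {x : Step} → m ≤ n → replicate m x ⊆ replicate n x
replicate⁺ {n = zero} z≤n = []
replicate⁺ {n = suc n} z≤n = _ ∷ʳ replicate⁺ {n = n} z≤n
replicate⁺ (s≤s m≤n) = refl ∷ replicate⁺ m≤n

⊆-replicate⁻ : ∀ {n} {x : Step} {w : Word} → w ⊆ replicate n x → ∃[ m ] m ≤ n × w ≡ replicate m x
⊆-replicate⁻ {zero} [] = 0 , z≤n , refl
⊆-replicate⁻ {suc n} (_ ∷ʳ σ) with m , m≤n , refl ← ⊆-replicate⁻ σ = m , m≤n⇒m≤1+n m≤n , refl
⊆-replicate⁻ {suc n} (refl ∷ σ) with m , m≤n , refl ← ⊆-replicate⁻ σ = suc m , s≤s m≤n , refl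

⊆-++⁻ : ∀ (xs : Word) {ys w} → w ⊆ xs ++ ys → ∃[ u ] ∃[ v ] w ≡ u ++ v × u ⊆ xs × v ⊆ ys
⊆-++⁻ [] σ = [] , _ , refl , [] , σ
⊆-++⁻ (x ∷ xs) (_ ∷ʳ σ) with u , v , refl , σu , σv ← ⊆-++⁻ xs σ = u , v , refl , x ∷ʳ σu , σv
⊆-++⁻ (x ∷ xs) (refl ∷ σ) with u , v , refl , σu , σv ← ⊆-++⁻ xs σ = x ∷ u , v , refl , refl ∷ σu , σv

replicate-++ : ∀ m n (x : Step) → replicate m x ++ replicate n x ≡ replicate (m + n) x
replicate-++ zero n x = refl
replicate-++ (suc m) n x = cong (x ∷_) (replicate-++ m n x)

replicate-++-∷-injective : ∀ {x y : Step} → x ≢ y → ∀ m n {v w} →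
  replicate m x ++ y ∷ v ≡ replicate n x ++ y ∷ w → m ≡ n × v ≡ w
replicate-++-∷-injective x≢y zero zero eq = refl , ∷-injectiveʳ eq
replicate-++-∷-injective x≢y zero (suc n) eq = ⊥-elim (x≢y (sym (∷-injectiveˡ eq)))
replicate-++-∷-injective x≢y (suc m) zero eq = ⊥-elim (x≢y (∷-injectiveˡ eq))
replicate-++-∷-injective x≢y (suc m) (suc n) eq
  with refl , refl ← replicate-++-∷-injective x≢y m n (∷-injectiveʳ eq) = refl , refl

replicate≢replicate-++-∷ : ∀ {x y : Step} → x ≢ y → ∀ m n {w} → replicate m x ≢ replicate n x ++ y ∷ w
replicate≢replicate-++-∷ x≢y zero zero ()
replicate≢replicate-++-∷ x≢y zero (suc n) ()
replicate≢replicate-++-∷ x≢y (suc m) zero eq = x≢y (∷-injectiveˡ eq)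
replicate≢replicate-++-∷ x≢y (suc m) (suc n) eq = replicate≢replicate-++-∷ x≢y m n (∷-injectiveʳ eq)

U≢D : U ≢ D
U≢D ()

D≢U : D ≢ U
D≢U ()

block : ℕ → ℕ → ℕ → ℕ → Word
block p q r s = replicate p U ++ replicate q D ++ replicate r U ++ replicate s D

block-mono : ∀ {p q r s p′ q′ r′ s′} → p ≤ p′ → q ≤ q′ → r ≤ r′ → s ≤ s′ →
             block p q r s ⊆ block p′ q′ r′ s′
block-mono p≤ q≤ r≤ s≤ = ++⁺ (replicate⁺ p≤) (++⁺ (replicate⁺ q≤) (++⁺ (replicate⁺ r≤) (replicate⁺ s≤)))

record SubBlock (p′ q′ r′ s′ : ℕ) (w : Word) : Set where
  constructor subBlock
  field
    {p q r s} : ℕ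
    p≤ : p ≤ p′
    q≤ : q ≤ q′
    r≤ : r ≤ r′
    s≤ : s ≤ s′
    w≡ : w ≡ block p q r s

⊆-block⁻ : ∀ p q r s {w} → w ⊆ block p q r s → SubBlock p q r s w
⊆-block⁻ p q r s σ
  with _ , _ , refl , σp , σ₁ ← ⊆-++⁻ (replicate p U) σ
  with _ , _ , refl , σq , σ₂ ← ⊆-++⁻ (replicate q D) σ₁
  with _ , _ , refl , σr , σs ← ⊆-++⁻ (replicate r U) σ₂
  with _ , p≤ , refl ← ⊆-replicate⁻ σp
  with _ , q≤ , refl ← ⊆-replicate⁻ σq
  with _ , r≤ , refl ← ⊆-replicate⁻ σr
  with _ , s≤ , refl ← ⊆-replicate⁻ σs
  = subBlock p≤ q≤ r≤ s≤ refl

climb⁻ : ∀ n {h} {w : Word} → FromHeight h (replicate n U ++ w) → FromHeight (n + h) w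
climb⁻ zero f = f
climb⁻ (suc n) {h} {w} (up f) = subst (λ k → FromHeight k w) (+-suc n h) (climb⁻ n f)

descend⁻ : ∀ n {h} {w : Word} → FromHeight h (replicate n D ++ w) → ∃[ h′ ] h ≡ n + h′ × FromHeight h′ w
descend⁻ zero f = _ , refl , f
descend⁻ (suc n) (down f) with h′ , refl , f′ ← descend⁻ n f = h′ , refl , f′

climb⁺ : ∀ n {h} {w : Word} → FromHeight (n + h) w → FromHeight h (replicate n U ++ w)
climb⁺ zero f = f
climb⁺ (suc n) {h} {w} f = up (climb⁺ n (subst (λ k → FromHeight k w) (sym (+-suc n h)) f))

descend⁺ : ∀ n {h} {w : Word} → FromHeight h w → FromHeight (n + h) (replicate n D ++ w)
descend⁺ zero f = f
descend⁺ (suc n) f = down (descend⁺ n f)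

descendAll⁻ : ∀ n {h} → FromHeight h (replicate n D) → h ≡ n
descendAll⁻ zero done = refl
descendAll⁻ (suc n) (down f) = cong suc (descendAll⁻ n f)

descendAll⁺ : ∀ n → FromHeight n (replicate n D)
descendAll⁺ zero = done
descendAll⁺ (suc n) = down (descendAll⁺ n)

block-Dyck⁻ : ∀ p q r s → Dyck (block p q r s) → ∃[ e ] p ≡ q + e × s ≡ r + e
block-Dyck⁻ p q r s f with e , p+0≡q+e , f′ ← descend⁻ q (climb⁻ p f) =
  e , trans (sym (+-identityʳ p)) p+0≡q+e , sym (descendAll⁻ s (climb⁻ r f′))

-- Every Dyck subword of U^a D^a U^b D^b has this form; e is the height of the valley.
dyckBlock : ℕ → ℕ → ℕ → Word
dyckBlock q r e = block (q + e) q r (r + e)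

dyckBlock-Dyck : ∀ q r e → Dyck (dyckBlock q r e)
dyckBlock-Dyck q r e = climb⁺ (q + e) (subst (λ h → FromHeight h (block 0 q r (r + e))) (sym (+-identityʳ (q + e)))
  (descend⁺ q (climb⁺ r (descendAll⁺ (r + e)))))

length-replicate-++ : ∀ n (x : Step) (w : Word) → length (replicate n x ++ w) ≡ n + length w
length-replicate-++ n x w = trans (length-++ (replicate n x)) (cong (_+ length w) (length-replicate n))

length-dyckBlock : ∀ q r e → length (dyckBlock q r e) ≡ 2 * (q + r + e)
length-dyckBlock q r e = begin
  length (dyckBlock q r e)              ≡⟨ length-replicate-++ (q + e) U _ ⟩
  q + e + length (block 0 q r (r + e))  ≡⟨ cong (q + e +_) (length-replicate-++ q D _) ⟩
  q + e + (q + length (block 0 0 r (r + e)))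
    ≡⟨ cong (λ n → q + e + (q + n)) (trans (length-replicate-++ r U _) (cong (r +_) (length-replicate (r + e)))) ⟩
  q + e + (q + (r + (r + e)))           ≡⟨ solve (q ∷ r ∷ e ∷ []) ⟩
  2 * (q + r + e)                       ∎
  where open ≡-Reasoning

-- Paths with at most two peaks

data Code : Set where
  single : ℕ → Code
  double : ℕ → ℕ → ℕ → Code

word : Code → Word
word (single n) = dyckBlock 0 0 (suc n)
word (double j d k) = dyckBlock (suc j) (suc k) d

word-Elem : ∀ c → Elem (word c)
word-Elem (single n) = dyckBlock-Dyck 0 0 (suc n) , λ ()
word-Elem (double j d k) = dyckBlock-Dyck (suc j) (suc k) d , λ ()

codeOf : ℕ → ℕ → ℕ → Code
codeOf zero zero zero = single 0 -- junk: dyckBlock 0 0 0 is empty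
codeOf zero zero (suc e) = single e
codeOf zero (suc r) e = single (r + e)
codeOf (suc q) zero e = single (q + e)
codeOf (suc q) (suc r) e = double q e r

word-codeOf : ∀ q r e → dyckBlock q r e ≢ [] → word (codeOf q r e) ≡ dyckBlock q r e
word-codeOf zero zero zero ne = ⊥-elim (ne refl)
word-codeOf zero zero (suc e) _ = refl
word-codeOf zero (suc r) e _ = begin
  replicate (suc r + e) U ++ Ds            ≡⟨ cong (λ n → replicate n U ++ Ds) (+-comm (suc r) e) ⟩
  replicate (e + suc r) U ++ Ds            ≡⟨ cong (_++ Ds) (replicate-++ e (suc r) U) ⟨
  (replicate e U ++ replicate (suc r) U) ++ Ds ≡⟨ ++-assoc (replicate e U) _ Ds ⟩
  dyckBlock zero (suc r) e                 ∎
  where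
  open ≡-Reasoning
  Ds : Word
  Ds = replicate (suc r + e) D
word-codeOf (suc q) zero e _ = cong (replicate (suc q + e) U ++_) (sym (replicate-++ (suc q) e D))
word-codeOf (suc q) (suc r) e _ = refl

Valid : ℕ → ℕ → Code → Set
Valid a b (single n) = suc n ≤ b
Valid a b (double j d k) = suc j + d ≤ a × suc k + d ≤ b

word-⊆-twoPeaks : ∀ {a b} c → Valid a b c → word c ⊆ twoPeaks a b
word-⊆-twoPeaks {a} (single n) n<b = block-mono {p = 0} {q = 0} {p′ = a} {q′ = a} z≤n z≤n n<b n<b
word-⊆-twoPeaks (double j d k) (jd<a , kd<b) =
  block-mono jd<a (≤-trans (m≤m+n (suc j) d) jd<a) (≤-trans (m≤m+n (suc k) d) kd<b) kd<b

codeOf-Valid : ∀ {a b} q r e → a ≤ b → q + e ≤ a → r + e ≤ b → dyckBlock q r e ≢ [] → Valid a b (codeOf q r e)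
codeOf-Valid zero zero zero _ _ _ ne = ⊥-elim (ne refl)
codeOf-Valid zero zero (suc e) _ _ re≤b _ = re≤b
codeOf-Valid zero (suc r) e _ _ re≤b _ = re≤b
codeOf-Valid (suc q) zero e a≤b qe≤a _ _ = ≤-trans qe≤a a≤b
codeOf-Valid (suc q) (suc r) e _ qe≤a re≤b _ = qe≤a , re≤b

classify : ∀ {a b} {Q : Word} → a ≤ b → Q ⊆ twoPeaks a b → Elem Q → ∃[ c ] Valid a b c × Q ≡ word c
classify {a} {b} a≤b σ (dQ , Q≢[])
  with subBlock {p} {q} {r} {s} p≤ _ _ s≤ refl ← ⊆-block⁻ a a b b σ
  with e , refl , refl ← block-Dyck⁻ p q r s dQ
  = codeOf q r e , codeOf-Valid q r e a≤b p≤ s≤ Q≢[] , sym (word-codeOf q r e Q≢[])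

-- Lower covers

-- The ways dyckBlock q r e can sit two letters below dyckBlock J K d.
data CoverShape (J K d q r e : ℕ) : Set where
  lowerValley  : q ≡ J → r ≡ K → d ≡ suc e → CoverShape J K d q r e
  shrinkFirst  : suc q ≡ J → r ≡ K → e ≡ d → CoverShape J K d q r e
  shrinkSecond : q ≡ J → suc r ≡ K → e ≡ d → CoverShape J K d q r e
  mergePeaks   : suc q ≡ J → suc r ≡ K → e ≡ suc d → CoverShape J K d q r e

-- With J = q + x and K = r + y: x + y + d = e + 1, e ≤ x + d and e ≤ y + d force x, y ≤ 1.
offsetShape : ∀ {q r d e} x y → x + y + d ≡ suc e → e ≤ x + d → e ≤ y + d → CoverShape (q + x) (r + y) d q r e
offsetShape {q} {r} {d} {e} x y sum≡ e≤x+d e≤y+d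
  with offset≤1 x y sum≡ e≤y+d | offset≤1 y x (trans (cong (_+ d) (+-comm y x)) sum≡) e≤x+d
  where
  offset≤1 : ∀ x y → x + y + d ≡ suc e → e ≤ y + d → x ≤ 1
  offset≤1 x y sum≡ e≤ = +-cancelʳ-≤ (y + d) x 1 (≤-trans (≤-reflexive (trans (sym (+-assoc x y d)) sum≡)) (s≤s e≤))
... | z≤n     | z≤n     = lowerValley (sym (+-identityʳ q)) (sym (+-identityʳ r)) sum≡
... | s≤s z≤n | z≤n     = shrinkFirst (+-comm 1 q) (sym (+-identityʳ r)) (suc-injective (sym sum≡))
... | z≤n     | s≤s z≤n = shrinkSecond (sym (+-identityʳ q)) (+-comm 1 r) (suc-injective (sym sum≡))
... | s≤s z≤n | s≤s z≤n = mergePeaks (+-comm 1 q) (+-comm 1 r) (suc-injective (sym sum≡))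

coverShape : ∀ {J K d q r e} → q ≤ J → r ≤ K → q + e ≤ J + d → r + e ≤ K + d →
             J + K + d ≡ suc (q + r + e) → CoverShape J K d q r e
coverShape {d = d} {q} {r} {e} q≤J r≤K qe≤Jd re≤Kd eq
  with x , refl ← m≤n⇒∃[o]m+o≡n q≤J | y , refl ← m≤n⇒∃[o]m+o≡n r≤K =
  offsetShape x y
    (+-cancelˡ-≡ (q + r) _ _ (begin
      q + r + (x + y + d)   ≡⟨ solve (q ∷ r ∷ x ∷ y ∷ d ∷ []) ⟩
      q + x + (r + y) + d   ≡⟨ eq ⟩
      suc (q + r + e)       ≡⟨ +-suc (q + r) e ⟨
      q + r + suc e         ∎))
    (+-cancelˡ-≤ q _ _ (≤-trans qe≤Jd (≤-reflexive (+-assoc q x d))))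
    (+-cancelˡ-≤ r _ _ (≤-trans re≤Kd (≤-reflexive (+-assoc r y d))))
  where open ≡-Reasoning

length-dyckBlock-2+ : ∀ J K d q r e →
  length (dyckBlock J K d) ≡ 2 + length (dyckBlock q r e) ⇔ J + K + d ≡ suc (q + r + e)
length-dyckBlock-2+ J K d q r e = mk⇔
  (λ eq → *-cancelˡ-≡ _ _ 2 (trans (sym lhs) (trans eq rhs)))
  (λ eq → trans lhs (trans (cong (2 *_) eq) (sym rhs)))
  where
  lhs : length (dyckBlock J K d) ≡ 2 * (J + K + d)
  lhs = length-dyckBlock J K d
  rhs : 2 + length (dyckBlock q r e) ≡ 2 * suc (q + r + e)
  rhs = trans (cong (2 +_) (length-dyckBlock q r e)) (sym (*-suc 2 (q + r + e)))

record SubDyckBlock (J K d : ℕ) (P : Word) : Set where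
  constructor subDyckBlock
  field
    {q r e} : ℕ
    q≤ : q ≤ J
    r≤ : r ≤ K
    qe≤ : q + e ≤ J + d
    re≤ : r + e ≤ K + d
    P≡ : P ≡ dyckBlock q r e

⊆-dyckBlock⁻ : ∀ J K d {P} → P ⊆ dyckBlock J K d → Dyck P → SubDyckBlock J K d P
⊆-dyckBlock⁻ J K d σ dP
  with subBlock {p} {q} {r} {s} p≤ q≤ r≤ s≤ refl ← ⊆-block⁻ (J + d) J K (K + d) σ
  with e , refl , refl ← block-Dyck⁻ p q r s dP
  = subDyckBlock q≤ r≤ p≤ s≤ refl

dyckBlock-cover : ∀ J K d q r e → q ≤ J → r ≤ K → q + e ≤ J + d → r + e ≤ K + d → J + K + d ≡ suc (q + r + e) →
                  dyckBlock q r e ⊆ dyckBlock J K d × length (dyckBlock J K d) ≡ 2 + length (dyckBlock q r e)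
dyckBlock-cover J K d q r e q≤J r≤K qe≤Jd re≤Kd eq =
  block-mono qe≤Jd q≤J r≤K re≤Kd , Equivalence.from (length-dyckBlock-2+ J K d q r e) eq

dyckBlock-valley≢[] : ∀ q r e → dyckBlock q r (suc e) ≢ []
dyckBlock-valley≢[] q r e eq =
  0≢1+n (trans (sym (cong length eq)) (trans (length-dyckBlock q r (suc e)) (cong (2 *_) (+-suc (q + r) e))))

onPred : (ℕ → Code) → ℕ → List Code
onPred f zero = []
onPred f (suc n) = f n ∷ []

∈-onPred⁻ : ∀ {f : ℕ → Code} n {c} → c ∈ onPred f n → ∃[ m ] n ≡ suc m × c ≡ f m
∈-onPred⁻ (suc m) (here refl) = m , refl , refl

-- Deleting a U and a D from a two-peak path: through the valley, or lowering the valley,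
-- or shrinking one of the peaks.
lowerCovers : Code → List Code
lowerCovers (single n) = onPred single n
lowerCovers (double j d k) =
  codeOf j k (suc d) ∷ onPred (λ d′ → double j d′ k) d ++ onPred (λ j′ → double j′ d k) j ++ onPred (double j d) k

lowerCovers-shrink : ∀ c {c′} → c′ ∈ lowerCovers c → word c′ ⊆ word c × length (word c) ≡ 2 + length (word c′)
lowerCovers-shrink (single (suc n)) (here refl) =
  dyckBlock-cover 0 0 (suc (suc n)) 0 0 (suc n) z≤n z≤n (n≤1+n _) (n≤1+n _) refl
lowerCovers-shrink (double j d k) (here refl)
  rewrite word-codeOf j k (suc d) (dyckBlock-valley≢[] j k d) =
  dyckBlock-cover (suc j) (suc k) d j k (suc d) (n≤1+n j) (n≤1+n k)
    (≤-reflexive (+-suc j d)) (≤-reflexive (+-suc k d)) (solve (j ∷ k ∷ d ∷ []))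
lowerCovers-shrink (double j d k) (there mem) with ∈-++⁻ (onPred _ d) mem
... | inj₁ mem′ with d′ , refl , refl ← ∈-onPred⁻ d mem′ =
  dyckBlock-cover (suc j) (suc k) d (suc j) (suc k) d′ ≤-refl ≤-refl
    (+-monoʳ-≤ (suc j) (n≤1+n d′)) (+-monoʳ-≤ (suc k) (n≤1+n d′)) (+-suc (suc j + suc k) d′)
... | inj₂ mem′ with ∈-++⁻ (onPred _ j) mem′
...   | inj₁ mem″ with j′ , refl , refl ← ∈-onPred⁻ j mem″ =
  dyckBlock-cover (suc j) (suc k) d j (suc k) d (n≤1+n j) ≤-refl (n≤1+n _) ≤-refl refl
...   | inj₂ mem″ with k′ , refl , refl ← ∈-onPred⁻ k mem″ =
  dyckBlock-cover (suc j) (suc k) d (suc j) k d ≤-refl (n≤1+n k) ≤-refl (n≤1+n _) (cong (_+ d) (+-suc (suc j) k))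

lowerCovers-sound : ∀ c {c′} → c′ ∈ lowerCovers c → word c′ ⋖ word c
lowerCovers-sound c {c′} mem = uncurry (length≡2+⇒⋖ (word-Elem c′) (word-Elem c)) (lowerCovers-shrink c mem)

codeOf-transferU : ∀ r e → codeOf 0 (suc r) e ≡ codeOf 0 r (suc e)
codeOf-transferU zero e = refl
codeOf-transferU (suc r) e = cong single (sym (+-suc r e))

codeOf-transferD : ∀ q e → codeOf (suc q) 0 e ≡ codeOf q 0 (suc e)
codeOf-transferD zero e = refl
codeOf-transferD (suc q) e = cong single (sym (+-suc q e))

shape-∈-lowerCovers : ∀ {j d k q r e} → CoverShape (suc j) (suc k) d q r e → codeOf q r e ∈ lowerCovers (double j d k)
shape-∈-lowerCovers (lowerValley refl refl refl) = there (here refl)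
shape-∈-lowerCovers {zero} {d} {k} (shrinkFirst refl refl refl) = here (codeOf-transferU k d)
shape-∈-lowerCovers {suc j} {d} (shrinkFirst refl refl refl) = there (∈-++⁺ʳ (onPred _ d) (here refl))
shape-∈-lowerCovers {j} {d} {zero} (shrinkSecond refl refl refl) = here (codeOf-transferD j d)
shape-∈-lowerCovers {j} {d} {suc k} (shrinkSecond refl refl refl) =
  there (∈-++⁺ʳ (onPred _ d) (∈-++⁺ʳ (onPred _ j) (here refl)))
shape-∈-lowerCovers (mergePeaks refl refl refl) = here refl

peak-∈-lowerCovers : ∀ e → dyckBlock 0 0 e ≢ [] → codeOf 0 0 e ∈ lowerCovers (single e)
peak-∈-lowerCovers zero ne = ⊥-elim (ne refl)
peak-∈-lowerCovers (suc e) _ = here refl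

lowerCovers-complete : ∀ c {P} → P ⋖ word c → ∃[ c′ ] c′ ∈ lowerCovers c × P ≡ word c′
lowerCovers-complete (single n) cov@((dP , P≢[]) , _ , (σ , _) , _)
  with subDyckBlock {e = e} z≤n z≤n _ _ refl ← ⊆-dyckBlock⁻ 0 0 (suc n) σ dP
  with refl ← suc-injective (Equivalence.to (length-dyckBlock-2+ 0 0 (suc n) 0 0 e) (⋖⇒length≡2+ cov)) =
  codeOf 0 0 e , peak-∈-lowerCovers e P≢[] , sym (word-codeOf 0 0 e P≢[])
lowerCovers-complete (double j d k) cov@((dP , P≢[]) , _ , (σ , _) , _)
  with subDyckBlock {q} {r} {e} q≤ r≤ qe≤ re≤ refl ← ⊆-dyckBlock⁻ (suc j) (suc k) d σ dP =
  codeOf q r e ,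
  shape-∈-lowerCovers (coverShape q≤ r≤ qe≤ re≤
    (Equivalence.to (length-dyckBlock-2+ (suc j) (suc k) d q r e) (⋖⇒length≡2+ cov))) ,
  sym (word-codeOf q r e P≢[])

module _ where
  open All using ([]; _∷_)
  open AllPairs using ([]; _∷_)

  lowerCovers-unique : ∀ c → Unique (lowerCovers c)
  lowerCovers-unique (single zero) = []
  lowerCovers-unique (single (suc n)) = [] ∷ []
  lowerCovers-unique (double zero zero zero) = [] ∷ []
  lowerCovers-unique (double zero zero (suc k)) = ((λ ()) ∷ []) ∷ [] ∷ []
  lowerCovers-unique (double zero (suc d) zero) = ((λ ()) ∷ []) ∷ [] ∷ []
  lowerCovers-unique (double zero (suc d) (suc k)) = ((λ ()) ∷ (λ ()) ∷ []) ∷ ((λ ()) ∷ []) ∷ [] ∷ []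
  lowerCovers-unique (double (suc j) zero zero) = ((λ ()) ∷ []) ∷ [] ∷ []
  lowerCovers-unique (double (suc j) zero (suc k)) = ((λ ()) ∷ (λ ()) ∷ []) ∷ ((λ ()) ∷ []) ∷ [] ∷ []
  lowerCovers-unique (double (suc j) (suc d) zero) = ((λ ()) ∷ (λ ()) ∷ []) ∷ ((λ ()) ∷ []) ∷ [] ∷ []
  lowerCovers-unique (double (suc j) (suc d) (suc k)) =
    ((λ ()) ∷ (λ ()) ∷ (λ ()) ∷ []) ∷ ((λ ()) ∷ (λ ()) ∷ []) ∷ ((λ ()) ∷ []) ∷ [] ∷ []

word-injective : ∀ {c c′} → word c ≡ word c′ → c ≡ c′
word-injective {single n} {single n′} eq
  with refl , _ ← replicate-++-∷-injective U≢D (suc n) (suc n′) eq = refl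
word-injective {single n} {double j′ d′ k′} eq =
  ⊥-elim (replicate≢replicate-++-∷ D≢U n j′ (proj₂ (replicate-++-∷-injective U≢D (suc n) (suc j′ + d′) eq)))
word-injective {double j d k} {single n′} eq =
  ⊥-elim (replicate≢replicate-++-∷ D≢U n′ j (sym (proj₂ (replicate-++-∷-injective U≢D (suc j + d) (suc n′) eq))))
word-injective {double j d k} {double j′ d′ k′} eq
  with jd≡ , eq₁ ← replicate-++-∷-injective U≢D (suc j + d) (suc j′ + d′) eq
  with refl , eq₂ ← replicate-++-∷-injective D≢U j j′ eq₁
  with refl , _ ← replicate-++-∷-injective U≢D k k′ eq₂
  with refl ← +-cancelˡ-≡ (suc j) d d′ jd≡ = refl

singles : ℕ → List Code
singles = applyDownFrom single

flatDouble : ℕ → ℕ → Code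
flatDouble j = double j 0

flatDoubles : ℕ → ℕ → List Code
flatDoubles a b = cartesianProductWith flatDouble (downFrom a) (downFrom b)

raiseValley : Code → Code
raiseValley (single n) = single n
raiseValley (double j d k) = double j (suc d) k

-- Raising the valley maps the doubles of the (a, b)-rectangle onto those of the
-- (a+1, b+1)-rectangle with a positive valley.
doubles : ℕ → ℕ → List Code
doubles zero b = []
doubles (suc a) zero = []
doubles (suc a) (suc b) = flatDoubles (suc a) (suc b) ++ map raiseValley (doubles a b)

codes : ℕ → ℕ → List Code
codes a b = singles b ++ doubles a b

Valid-raiseValley : ∀ {a b} c → Valid a b c → Valid (suc a) (suc b) (raiseValley c)
Valid-raiseValley (single n) n<b = m≤n⇒m≤1+n n<b
Valid-raiseValley (double j d k) (jd<a , kd<b) =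
  ≤-trans (≤-reflexive (+-suc (suc j) d)) (s≤s jd<a) , ≤-trans (≤-reflexive (+-suc (suc k) d)) (s≤s kd<b)

∈-doubles⁻ : ∀ a b {c} → c ∈ doubles a b → Valid a b c
∈-doubles⁻ (suc a) (suc b) mem with ∈-++⁻ (flatDoubles (suc a) (suc b)) mem
... | inj₁ flat with j , k , j∈ , k∈ , refl ← ∈-cartesianProductWith⁻ flatDouble (downFrom (suc a)) _ flat =
  ≤-trans (≤-reflexive (+-identityʳ (suc j))) (∈-downFrom⁻ j∈) ,
  ≤-trans (≤-reflexive (+-identityʳ (suc k))) (∈-downFrom⁻ k∈)
... | inj₂ raised with c , c∈ , refl ← ∈-map⁻ raiseValley raised = Valid-raiseValley c (∈-doubles⁻ a b c∈)

∈-doubles⁺ : ∀ a b j d k → Valid a b (double j d k) → double j d k ∈ doubles a b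
∈-doubles⁺ (suc a) (suc b) j zero k (j<a , k<b) = ∈-++⁺ˡ (∈-cartesianProductWith⁺ flatDouble
  (∈-downFrom⁺ (m+n≤o⇒m≤o (suc j) j<a)) (∈-downFrom⁺ (m+n≤o⇒m≤o (suc k) k<b)))
∈-doubles⁺ (suc a) (suc b) j (suc d) k (jd<a , kd<b) = ∈-++⁺ʳ (flatDoubles (suc a) (suc b)) (∈-map⁺ raiseValley
  (∈-doubles⁺ a b j d k (≤-pred (≤-trans (≤-reflexive (sym (+-suc (suc j) d))) jd<a) ,
                         ≤-pred (≤-trans (≤-reflexive (sym (+-suc (suc k) d))) kd<b))))

∈-codes⇔Valid : ∀ a b c → c ∈ codes a b ⇔ Valid a b c
∈-codes⇔Valid a b c = mk⇔ to (from c)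
  where
  to : c ∈ codes a b → Valid a b c
  to mem with ∈-++⁻ (singles b) mem
  ... | inj₁ single∈ with n , n<b , refl ← ∈-applyDownFrom⁻ single single∈ = n<b
  ... | inj₂ double∈ = ∈-doubles⁻ a b double∈
  from : ∀ c → Valid a b c → c ∈ codes a b
  from (single n) n<b = ∈-++⁺ˡ (∈-applyDownFrom⁺ single n<b)
  from (double j d k) valid = ∈-++⁺ʳ (singles b) (∈-doubles⁺ a b j d k valid)

raiseValley-injective : ∀ {c c′} → raiseValley c ≡ raiseValley c′ → c ≡ c′
raiseValley-injective {single _} {single _} refl = refl
raiseValley-injective {double _ _ _} {double _ _ _} refl = refl

single∉doubles : ∀ a b n → single n ∉ doubles a b
single∉doubles (suc a) (suc b) n mem with ∈-++⁻ (flatDoubles (suc a) (suc b)) mem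
... | inj₁ flat with _ , _ , _ , _ , () ← ∈-cartesianProductWith⁻ flatDouble (downFrom (suc a)) _ flat
... | inj₂ raised with ∈-map⁻ raiseValley raised
...   | single _ , single∈ , refl = single∉doubles a b n single∈

doubles-unique : ∀ a b → Unique (doubles a b)
doubles-unique zero b = AllPairs.[]
doubles-unique (suc a) zero = AllPairs.[]
doubles-unique (suc a) (suc b) =
  Uniqueₚ.++⁺ (Uniqueₚ.cartesianProductWith⁺ flatDouble (λ { refl → refl , refl })
                 (Uniqueₚ.downFrom⁺ (suc a)) (Uniqueₚ.downFrom⁺ (suc b)))
              (Uniqueₚ.map⁺ raiseValley-injective (doubles-unique a b))
      flat∉raised
  where
  flat∉raised : Disjoint (flatDoubles (suc a) (suc b)) (map raiseValley (doubles a b))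
  flat∉raised (flat , raised)
    with _ , _ , _ , _ , refl ← ∈-cartesianProductWith⁻ flatDouble (downFrom (suc a)) _ flat
    with single _ , _ , () ← ∈-map⁻ raiseValley raised

codes-unique : ∀ a b → Unique (codes a b)
codes-unique a b = Uniqueₚ.++⁺ singles-unique (doubles-unique a b) singles∉doubles
  where
  singles-unique : Unique (singles b)
  singles-unique = Uniqueₚ.applyDownFrom⁺₁ single b λ { j<i _ refl → <-irrefl refl j<i }
  singles∉doubles : Disjoint (singles b) (doubles a b)
  singles∉doubles (single∈ , double∈) with n , _ , refl ← ∈-applyDownFrom⁻ single single∈ =
    single∉doubles a b n double∈

coversBelow : Code → List (Word × Word)
coversBelow c = map (λ c′ → word c′ , word c) (lowerCovers c)

coverPairs : ℕ → ℕ → List (Word × Word)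
coverPairs a b = concatMap coversBelow (codes a b)

coversBelow-unique : ∀ c → Unique (coversBelow c)
coversBelow-unique c = Uniqueₚ.map⁺ (λ eq → word-injective (cong proj₁ eq)) (lowerCovers-unique c)

coversBelow-disjoint : ∀ {c c′} → c ≢ c′ → Disjoint (coversBelow c) (coversBelow c′)
coversBelow-disjoint c≢c′ (x∈ , x∈′)
  with _ , _ , refl ← ∈-map⁻ _ x∈ | _ , _ , eq ← ∈-map⁻ _ x∈′ = c≢c′ (word-injective (cong proj₂ eq))

coverPairs-unique : ∀ a b → Unique (coverPairs a b)
coverPairs-unique a b = Uniqueₚ.concat⁺
  (Allₚ.map⁺ (All.universal coversBelow-unique (codes a b)))
  (AllPairsₚ.map⁺ (AllPairs.map coversBelow-disjoint (codes-unique a b)))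

∈-coverPairs⇔CoverIn : ∀ {a b} → a ≤ b → ∀ x → x ∈ coverPairs a b ⇔ CoverIn UD (twoPeaks a b) x
∈-coverPairs⇔CoverIn {a} {b} a≤b x = mk⇔ to (from x)
  where
  to : x ∈ coverPairs a b → CoverIn UD (twoPeaks a b) x
  to x∈ with c , c∈ , x∈′ ← find (∈-concatMap⁻ coversBelow x∈)
        with c′ , c′∈ , refl ← ∈-map⁻ _ x∈′ =
    (word-Elem c′ , UD⊆ (word-Elem c′) , ⊆-trans (⋖⇒⊆ c′⋖c) Q⊆) ,
    (word-Elem c , UD⊆ (word-Elem c) , Q⊆) ,
    c′⋖c
    where
    c′⋖c : word c′ ⋖ word c
    c′⋖c = lowerCovers-sound c c′∈
    Q⊆ : word c ⊆ twoPeaks a b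
    Q⊆ = word-⊆-twoPeaks c (Equivalence.to (∈-codes⇔Valid a b c) c∈)
  from : ∀ x → CoverIn UD (twoPeaks a b) x → x ∈ coverPairs a b
  from (P , Q) (_ , (eQ , _ , Q⊆) , P⋖Q)
    with c , valid , refl ← classify a≤b Q⊆ eQ
    with c′ , c′∈ , refl ← lowerCovers-complete c P⋖Q =
    ∈-concatMap⁺ coversBelow (lose (Equivalence.from (∈-codes⇔Valid a b c) valid) (∈-map⁺ _ c′∈))

-- Counting

sumOver : (Code → ℕ) → List Code → ℕ
sumOver f cs = sum (map f cs)

sumOver-++ : ∀ f xs ys → sumOver f (xs ++ ys) ≡ sumOver f xs + sumOver f ys
sumOver-++ f xs ys = trans (cong sum (map-++ f xs ys)) (sum-++ (map f xs) (map f ys))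

lowerCount : Code → ℕ
lowerCount c = length (lowerCovers c)

length-coverPairs : ∀ a b → length (coverPairs a b) ≡ sumOver lowerCount (codes a b)
length-coverPairs a b = go (codes a b)
  where
  go : ∀ cs → length (concatMap coversBelow cs) ≡ sumOver lowerCount cs
  go [] = refl
  go (c ∷ cs) = trans (length-++ (coversBelow c)) (cong₂ _+_ (length-map _ (lowerCovers c)) (go cs))

flatness : Code → ℕ
flatness (double _ zero _) = 1
flatness _ = 0

-- Only the "lower the valley" cover is gained, and only when the valley was at height 0.
lowerCount-raiseValley : ∀ c → lowerCount (raiseValley c) ≡ lowerCount c + flatness c
lowerCount-raiseValley (single n) = sym (+-identityʳ _)
lowerCount-raiseValley (double zero zero zero) = refl
lowerCount-raiseValley (double zero zero (suc k)) = refl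
lowerCount-raiseValley (double (suc j) zero zero) = refl
lowerCount-raiseValley (double (suc j) zero (suc k)) = refl
lowerCount-raiseValley (double zero (suc d) zero) = refl
lowerCount-raiseValley (double zero (suc d) (suc k)) = refl
lowerCount-raiseValley (double (suc j) (suc d) zero) = refl
lowerCount-raiseValley (double (suc j) (suc d) (suc k)) = refl

sumOver-raiseValley : ∀ cs → sumOver lowerCount (map raiseValley cs) ≡ sumOver lowerCount cs + sumOver flatness cs
sumOver-raiseValley [] = refl
sumOver-raiseValley (c ∷ cs) = trans (cong₂ _+_ (lowerCount-raiseValley c) (sumOver-raiseValley cs))
  (interchange (lowerCount c) (flatness c) (sumOver lowerCount cs) (sumOver flatness cs))

sumOver-flatness-raiseValley : ∀ cs → sumOver flatness (map raiseValley cs) ≡ 0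
sumOver-flatness-raiseValley [] = refl
sumOver-flatness-raiseValley (single _ ∷ cs) = sumOver-flatness-raiseValley cs
sumOver-flatness-raiseValley (double _ _ _ ∷ cs) = sumOver-flatness-raiseValley cs

row-lowerCount₀ : ∀ b → sumOver lowerCount (map (flatDouble 0) (downFrom (suc b))) ≡ 1 + 2 * b
row-lowerCount₀ zero = refl
row-lowerCount₀ (suc b) = trans (cong (2 +_) (row-lowerCount₀ b)) (cong suc (sym (*-suc 2 b)))

row-lowerCountₛ : ∀ j b → sumOver lowerCount (map (flatDouble (suc j)) (downFrom (suc b))) ≡ 2 + 3 * b
row-lowerCountₛ j zero = refl
row-lowerCountₛ j (suc b) = trans (cong (3 +_) (row-lowerCountₛ j b)) (cong (2 +_) (sym (*-suc 3 b)))

row-flatness : ∀ j b → sumOver flatness (map (flatDouble j) (downFrom b)) ≡ b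
row-flatness j zero = refl
row-flatness j (suc b) = cong suc (row-flatness j b)

flatDoubles-lowerCount : ∀ a b → sumOver lowerCount (flatDoubles (suc a) (suc b)) ≡ 1 + 2 * b + a * (2 + 3 * b)
flatDoubles-lowerCount zero b = begin
  sumOver lowerCount (map (flatDouble 0) (downFrom (suc b)) ++ [])
    ≡⟨ cong (sumOver lowerCount) (++-identityʳ (map (flatDouble 0) (downFrom (suc b)))) ⟩
  sumOver lowerCount (map (flatDouble 0) (downFrom (suc b)))        ≡⟨ row-lowerCount₀ b ⟩
  1 + 2 * b                                                         ≡⟨ +-identityʳ _ ⟨
  1 + 2 * b + 0                                                     ∎
  where open ≡-Reasoning
flatDoubles-lowerCount (suc a) b = begin
  sumOver lowerCount (map (flatDouble (suc a)) (downFrom (suc b)) ++ flatDoubles (suc a) (suc b))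
    ≡⟨ sumOver-++ lowerCount (map (flatDouble (suc a)) (downFrom (suc b))) _ ⟩
  sumOver lowerCount (map (flatDouble (suc a)) (downFrom (suc b))) + sumOver lowerCount (flatDoubles (suc a) (suc b))
    ≡⟨ cong₂ _+_ (row-lowerCountₛ a b) (flatDoubles-lowerCount a b) ⟩
  2 + 3 * b + (1 + 2 * b + a * (2 + 3 * b))
    ≡⟨ solve (a ∷ b ∷ []) ⟩
  1 + 2 * b + suc a * (2 + 3 * b) ∎
  where open ≡-Reasoning

flatDoubles-flatness : ∀ a b → sumOver flatness (flatDoubles a b) ≡ a * b
flatDoubles-flatness zero b = refl
flatDoubles-flatness (suc a) b = trans (sumOver-++ flatness (map (flatDouble a) (downFrom b)) _)
  (cong₂ _+_ (row-flatness a b) (flatDoubles-flatness a b))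

doubles-flatness : ∀ a b → sumOver flatness (doubles a b) ≡ a * b
doubles-flatness zero b = refl
doubles-flatness (suc a) zero = sym (*-zeroʳ a)
doubles-flatness (suc a) (suc b) = trans (sumOver-++ flatness (flatDoubles (suc a) (suc b)) _)
  (trans (cong₂ _+_ (flatDoubles-flatness (suc a) (suc b)) (sumOver-flatness-raiseValley (doubles a b))) (+-identityʳ _))

doubles-lowerCount-step : ∀ a b → sumOver lowerCount (doubles (suc a) (suc b)) ≡
  (1 + 2 * b + a * (2 + 3 * b)) + (sumOver lowerCount (doubles a b) + a * b)
doubles-lowerCount-step a b = trans (sumOver-++ lowerCount (flatDoubles (suc a) (suc b)) _)
  (cong₂ _+_ (flatDoubles-lowerCount a b)
             (trans (sumOver-raiseValley (doubles a b)) (cong (sumOver lowerCount (doubles a b) +_) (doubles-flatness a b))))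

closedForm-step : ∀ a b F → 3 * F + 2 * (a * a * a) + a ≡ 6 * (a * a) * b →
  3 * ((1 + 2 * b + a * (2 + 3 * b)) + (F + a * b)) + 2 * (suc a * suc a * suc a) + suc a ≡ 6 * (suc a * suc a) * suc b
closedForm-step a b F closedForm = begin
  3 * ((1 + 2 * b + a * (2 + 3 * b)) + (F + a * b)) + 2 * (suc a * suc a * suc a) + suc a
    ≡⟨ cong (λ m → 3 * ((1 + 2 * b + a * (2 + 3 * b)) + (F + a * b)) + 2 * (m * m * m) + m) (+-comm 1 a) ⟩
  3 * ((1 + 2 * b + a * (2 + 3 * b)) + (F + a * b)) + 2 * ((a + 1) * (a + 1) * (a + 1)) + (a + 1)
    ≡⟨ solve (a ∷ b ∷ F ∷ []) ⟩
  (3 * F + 2 * (a * a * a) + a) + (6 * (a * a) + 12 * a * b + 12 * a + 6 * b + 6)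
    ≡⟨ cong (_+ (6 * (a * a) + 12 * a * b + 12 * a + 6 * b + 6)) closedForm ⟩
  6 * (a * a) * b + (6 * (a * a) + 12 * a * b + 12 * a + 6 * b + 6)
    ≡⟨ solve (a ∷ b ∷ []) ⟩
  6 * ((a + 1) * (a + 1)) * (b + 1)
    ≡⟨ cong₂ (λ m n → 6 * (m * m) * n) (+-comm a 1) (+-comm b 1) ⟩
  6 * (suc a * suc a) * suc b ∎
  where open ≡-Reasoning

doubles-lowerCount : ∀ a b → a ≤ b → 3 * sumOver lowerCount (doubles a b) + 2 * (a * a * a) + a ≡ 6 * (a * a) * b
doubles-lowerCount zero b _ = refl
doubles-lowerCount (suc a) (suc b) (s≤s a≤b) =
  trans (cong (λ n → 3 * n + 2 * (suc a * suc a * suc a) + suc a) (doubles-lowerCount-step a b))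
        (closedForm-step a b _ (doubles-lowerCount a b a≤b))

singles-lowerCount : ∀ b → sumOver lowerCount (singles (suc b)) ≡ b
singles-lowerCount zero = refl
singles-lowerCount (suc b) = cong suc (singles-lowerCount b)

codes-closedForm : ∀ a b F → 3 * F + 2 * (a * a * a) + a ≡ 6 * (a * a) * suc b →
  3 * (b + F) + (2 * a ^ 3 + a + 3) ≡ 6 * a ^ 2 * suc b + 3 * suc b
codes-closedForm a b F closedForm = begin
  3 * (b + F) + (2 * (a * (a * (a * 1))) + a + 3)   ≡⟨ solve (a ∷ b ∷ F ∷ []) ⟩
  (3 * F + 2 * (a * a * a) + a) + 3 * (b + 1)      ≡⟨ cong₂ _+_ closedForm (cong (3 *_) (+-comm b 1)) ⟩
  6 * (a * a) * suc b + 3 * suc b                  ≡⟨ cong (λ m → 6 * (a * m) * suc b + 3 * suc b) (*-identityʳ a) ⟨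
  6 * a ^ 2 * suc b + 3 * suc b                    ∎
  where open ≡-Reasoning

codes-lowerCount : ∀ a b → a ≤ suc b →
  3 * sumOver lowerCount (codes a (suc b)) + (2 * a ^ 3 + a + 3) ≡ 6 * a ^ 2 * suc b + 3 * suc b
codes-lowerCount a b a≤b =
  trans (cong (λ n → 3 * n + (2 * a ^ 3 + a + 3))
          (trans (sumOver-++ lowerCount (singles (suc b)) (doubles a (suc b)))
                 (cong (_+ sumOver lowerCount (doubles a (suc b))) (singles-lowerCount b))))
        (codes-closedForm a b _ (doubles-lowerCount a (suc b) a≤b))

mainTheorem9 : (a b : ℕ) → 1 ≤ a → a ≤ b →
    Σ ℕ λ n → HasCard (CoverIn UD (twoPeaks a b)) n ×
      (3 * n + (2 * a ^ 3 + a + 3) ≡ 6 * a ^ 2 * b + 3 * b)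
mainTheorem9 a zero 1≤a a≤0 = ⊥-elim (<-irrefl refl (≤-trans 1≤a a≤0))
mainTheorem9 a (suc b) _ a≤b =
  length (coverPairs a (suc b)) ,
  (coverPairs a (suc b) , coverPairs-unique a (suc b) , ∈-coverPairs⇔CoverIn a≤b , refl) ,
  (begin
    3 * length (coverPairs a (suc b)) + (2 * a ^ 3 + a + 3)          ≡⟨ cong (λ n → 3 * n + _) (length-coverPairs a (suc b)) ⟩
    3 * sumOver lowerCount (codes a (suc b)) + (2 * a ^ 3 + a + 3)   ≡⟨ codes-lowerCount a b a≤b ⟩
    6 * a ^ 2 * suc b + 3 * suc b                                    ∎)
  where open ≡-Reasoning
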